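{- Every bipartite graph with no cycle of length $4$ (as a subgraph) has VC-dimension at most $2$.
   Context: For a vertex $v$, $N[v]$ is its closed neighbourhood. The VC-dimension of a graph $G$ is the largest size of a set $X\subseteq V(G)$ such that for every $S\subseteq X$ some vertex $v$ satisfies $N[v]\cap X=S$. -}

module Defs where

open import Data.Nat using (ℕ; _≤_)
open import Data.Fin using (Fin)
open import Data.Bool using (Bool)
open import Data.Product using (_×_; Σ; ∃)
open import Data.Sum using (_⊎_)
open import Data.Empty using (⊥)
open import Relation.Nullary using (¬_)
open import Relation.Binary.PropositionalEquality using (_≡_; _≢_)
open import Data.Fin.Subset using (Subset; _∈_; _⊆_; ∣_∣)
open import Function.Bundles using (_⇔_)

record Graph (n : ℕ) : Set₁ where
  field
    Adj     : Fin n → Fin n → Set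
    sym     : ∀ {u v} → Adj u v → Adj v u
    irrefl  : ∀ {u} → ¬ Adj u u

open Graph public

InClosedNbhd : ∀ {n} → Graph n → Fin n → Fin n → Set
InClosedNbhd G v u = (u ≡ v) ⊎ Adj G v u

Shattered : ∀ {n} → Graph n → Subset n → Set
Shattered {n} G X =
  ∀ (S : Subset n) → S ⊆ X →
    ∃ λ (v : Fin n) → ∀ (u : Fin n) → ((u ∈ X × InClosedNbhd G v u) ⇔ u ∈ S)

VCDimAtMost : ∀ {n} → Graph n → ℕ → Set
VCDimAtMost G d = ∀ X → Shattered G X → ∣ X ∣ ≤ d

Bipartite : ∀ {n} → Graph n → Set
Bipartite {n} G = ∃ λ (c : Fin n → Bool) → ∀ {u v} → Adj G u v → c u ≢ c v

HasC4 : ∀ {n} → Graph n → Set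
HasC4 {n} G = Σ (Fin n) λ a → Σ (Fin n) λ b → Σ (Fin n) λ c → Σ (Fin n) λ d →
  (a ≢ b × a ≢ c × a ≢ d × b ≢ c × b ≢ d × c ≢ d) ×
  (Adj G a b × Adj G b c × Adj G c d × Adj G d a)

-- Suppose a shattered set contains three distinct vertices; two of them, a and b,
-- share a colour.  Let v realise {a, b} and w realise the whole set.  Since a and b
-- are distinct and of the same colour, neither is a neighbour of the other, so both
-- v and w are adjacent to both a and b; and v ≠ w because only w picks up the third
-- vertex.  Then v a w b is a 4-cycle.
module Submission where

open import Defs
open import Data.Nat using (ℕ; _≤_; _+_; z≤n; s≤s)
open import Data.Nat.Properties using (≤-trans; ≤-reflexive; +-monoʳ-≤; +-suc; n≤1+n)
open import Data.Bool using (Bool; true; false)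
open import Data.Vec using ([]; _∷_)
open import Data.Fin using (Fin)
open import Data.Fin.Properties using (any?)
open import Data.Fin.Subset using (Subset; _∈_; _∉_; _⊆_; ∣_∣; _∪_; ⁅_⁆; ⊥; inside; outside)
open import Data.Fin.Subset.Properties
  using (_∈?_; x∈p∪q⁻; x∈p∪q⁺; x∈⁅x⁆; x∈⁅y⁆⇒x≡y; x∉⁅y⁆⇒x≢y; ∣⁅x⁆∣≡1; ∣⊥∣≡0; p⊆q⇒∣p∣≤∣q∣)
open import Data.Product using (_×_; _,_; ∃; proj₂)
open import Data.Sum using (_⊎_; inj₁; inj₂; [_,_])
open import Data.Sum.Base as Sum using ()
open import Data.Empty using (⊥-elim)
open import Function using (_∘_)
open import Function.Bundles using (_⇔_; mk⇔; Equivalence)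
open import Relation.Nullary using (¬_; yes; no)
open import Relation.Nullary.Decidable using (_×-dec_; ¬?; decidable-stable)
open import Relation.Binary.PropositionalEquality
  using (_≡_; _≢_; refl; cong₂; subst; ≢-sym) renaming (sym to ≡-sym)

open Equivalence using (to; from)

∣p∪q∣≤∣p∣+∣q∣ : ∀ {n} (p q : Subset n) → ∣ p ∪ q ∣ ≤ ∣ p ∣ + ∣ q ∣
∣p∪q∣≤∣p∣+∣q∣ []            []            = z≤n
∣p∪q∣≤∣p∣+∣q∣ (inside  ∷ p) (inside  ∷ q) = s≤s (≤-trans (∣p∪q∣≤∣p∣+∣q∣ p q) (+-monoʳ-≤ ∣ p ∣ (n≤1+n _)))
∣p∪q∣≤∣p∣+∣q∣ (inside  ∷ p) (outside ∷ q) = s≤s (∣p∪q∣≤∣p∣+∣q∣ p q)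
∣p∪q∣≤∣p∣+∣q∣ (outside ∷ p) (inside  ∷ q) = ≤-trans (s≤s (∣p∪q∣≤∣p∣+∣q∣ p q)) (≤-reflexive (≡-sym (+-suc _ _)))
∣p∪q∣≤∣p∣+∣q∣ (outside ∷ p) (outside ∷ q) = ∣p∪q∣≤∣p∣+∣q∣ p q

module _ {n : ℕ} where

  z∈⁅x⁆∪⁅y⁆⇔ : ∀ {x y z : Fin n} → z ∈ ⁅ x ⁆ ∪ ⁅ y ⁆ ⇔ (z ≡ x ⊎ z ≡ y)
  z∈⁅x⁆∪⁅y⁆⇔ {x} {y} = mk⇔
    (Sum.map (x∈⁅y⁆⇒x≡y x) (x∈⁅y⁆⇒x≡y y) ∘ x∈p∪q⁻ _ _)
    (x∈p∪q⁺ ∘ Sum.map (λ { refl → x∈⁅x⁆ x }) (λ { refl → x∈⁅x⁆ y }))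

  ∣⁅x⁆∪⁅y⁆∣≤2 : ∀ (x y : Fin n) → ∣ ⁅ x ⁆ ∪ ⁅ y ⁆ ∣ ≤ 2
  ∣⁅x⁆∪⁅y⁆∣≤2 x y = ≤-trans (∣p∪q∣≤∣p∣+∣q∣ ⁅ x ⁆ ⁅ y ⁆) (≤-reflexive (cong₂ _+_ (∣⁅x⁆∣≡1 x) (∣⁅x⁆∣≡1 y)))

  ⊆-or-escape : ∀ (p q : Subset n) → p ⊆ q ⊎ ∃ λ z → z ∈ p × z ∉ q
  ⊆-or-escape p q with any? (λ z → z ∈? p ×-dec ¬? (z ∈? q))
  ... | yes escape = inj₂ escape
  ... | no ¬escape = inj₁ λ {z} z∈p → decidable-stable (z ∈? q) (λ z∉q → ¬escape (z , z∈p , z∉q))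

  -- Each failure to cover p by ⊥, ⁅ x ⁆, ⁅ x ⁆ ∪ ⁅ y ⁆ yields one more distinct element.
  noThreeDistinct⇒∣p∣≤2 : ∀ (p : Subset n) →
    (∀ {x y z} → x ∈ p → y ∈ p → z ∈ p → x ≢ y → x ≢ z → y ≢ z → Data.Empty.⊥) →
    ∣ p ∣ ≤ 2
  noThreeDistinct⇒∣p∣≤2 p none with ⊆-or-escape p ⊥
  ... | inj₁ p⊆⊥ = ≤-trans (p⊆q⇒∣p∣≤∣q∣ p⊆⊥) (subst (_≤ 2) (≡-sym (∣⊥∣≡0 n)) z≤n)
  ... | inj₂ (x , x∈p , _) with ⊆-or-escape p ⁅ x ⁆
  ...   | inj₁ p⊆⁅x⁆ = ≤-trans (p⊆q⇒∣p∣≤∣q∣ p⊆⁅x⁆) (subst (_≤ 2) (≡-sym (∣⁅x⁆∣≡1 x)) (s≤s z≤n))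
  ...   | inj₂ (y , y∈p , y∉⁅x⁆) with ⊆-or-escape p (⁅ x ⁆ ∪ ⁅ y ⁆)
  ...     | inj₁ p⊆⁅x⁆∪⁅y⁆ = ≤-trans (p⊆q⇒∣p∣≤∣q∣ p⊆⁅x⁆∪⁅y⁆) (∣⁅x⁆∪⁅y⁆∣≤2 x y)
  ...     | inj₂ (z , z∈p , z∉⁅x⁆∪⁅y⁆) = ⊥-elim (none x∈p y∈p z∈p
              (≢-sym (x∉⁅y⁆⇒x≢y y∉⁅x⁆))
              (≢-sym (z∉⁅x⁆∪⁅y⁆ ∘ from z∈⁅x⁆∪⁅y⁆⇔ ∘ inj₁))
              (≢-sym (z∉⁅x⁆∪⁅y⁆ ∘ from z∈⁅x⁆∪⁅y⁆⇔ ∘ inj₂)))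

twoOfThreeEqual : ∀ (x y z : Bool) → x ≡ y ⊎ x ≡ z ⊎ y ≡ z
twoOfThreeEqual false false _     = inj₁ refl
twoOfThreeEqual true  true  _     = inj₁ refl
twoOfThreeEqual false true  false = inj₂ (inj₁ refl)
twoOfThreeEqual true  false true  = inj₂ (inj₁ refl)
twoOfThreeEqual false true  true  = inj₂ (inj₂ refl)
twoOfThreeEqual true  false false = inj₂ (inj₂ refl)

Realises : ∀ {n} → Graph n → Subset n → Fin n → Subset n → Set
Realises G X v S = ∀ u → (u ∈ X × InClosedNbhd G v u) ⇔ u ∈ S

module _ {n : ℕ} (G : Graph n) where

  adj⇒≢ : ∀ {u v} → Adj G u v → u ≢ v
  adj⇒≢ uv refl = irrefl G uv

  twoCommonNeighbours⇒HasC4 : ∀ {a b u v} → a ≢ b → u ≢ v →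
    Adj G u a → Adj G u b → Adj G v a → Adj G v b → HasC4 G
  twoCommonNeighbours⇒HasC4 a≢b u≢v ua ub va vb =
    _ , _ , _ , _ ,
    (adj⇒≢ ua , u≢v , adj⇒≢ ub , ≢-sym (adj⇒≢ va) , a≢b , adj⇒≢ vb) ,
    (ua , sym G va , vb , sym G ub)

  realisers-≢ : ∀ {X S T u v w} → Realises G X v S → Realises G X w T → u ∈ T → u ∉ S → v ≢ w
  realisers-≢ {u = u} v-realises w-realises u∈T u∉S refl = u∉S (to (v-realises u) (from (w-realises u) u∈T))

  module _ {c : Fin n → Bool} (proper : ∀ {u v} → Adj G u v → c u ≢ c v) where

    sameColour⇒adj : ∀ {a b w} → a ≢ b → c a ≡ c b →
      InClosedNbhd G w a → InClosedNbhd G w b → Adj G w a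
    sameColour⇒adj _   _     (inj₂ wa)   _           = wa
    sameColour⇒adj a≢b _     (inj₁ refl) (inj₁ refl) = ⊥-elim (a≢b refl)
    sameColour⇒adj _   ca≡cb (inj₁ refl) (inj₂ ab)   = ⊥-elim (proper ab ca≡cb)

    realiser-adj : ∀ {X S v a b} → Realises G X v S → a ≢ b → c a ≡ c b → a ∈ S → b ∈ S → Adj G v a
    realiser-adj {a = a} {b} v-realises a≢b ca≡cb a∈S b∈S
      with from (v-realises a) a∈S | from (v-realises b) b∈S
    ... | _ , a∈N[v] | _ , b∈N[v] = sameColour⇒adj a≢b ca≡cb a∈N[v] b∈N[v]

    realisers⇒HasC4 : ∀ {X S T v w a b d} → Realises G X v S → Realises G X w T →
      a ≢ b → c a ≡ c b → a ∈ S → b ∈ S → a ∈ T → b ∈ T → d ∈ T → d ∉ S → HasC4 G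
    realisers⇒HasC4 v-realises w-realises a≢b ca≡cb a∈S b∈S a∈T b∈T d∈T d∉S =
      twoCommonNeighbours⇒HasC4 a≢b (realisers-≢ v-realises w-realises d∈T d∉S)
        (realiser-adj v-realises a≢b ca≡cb a∈S b∈S)
        (realiser-adj v-realises (≢-sym a≢b) (≡-sym ca≡cb) b∈S a∈S)
        (realiser-adj w-realises a≢b ca≡cb a∈T b∈T)
        (realiser-adj w-realises (≢-sym a≢b) (≡-sym ca≡cb) b∈T a∈T)

    shattered-sameColour⇒HasC4 : ∀ {X a b d} → Shattered G X →
      a ∈ X → b ∈ X → d ∈ X → a ≢ b → a ≢ d → b ≢ d → c a ≡ c b → HasC4 G
    shattered-sameColour⇒HasC4 {X} {a} {b} {d} X-shattered a∈X b∈X d∈X a≢b a≢d b≢d ca≡cb =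
      realisers⇒HasC4 (proj₂ (X-shattered (⁅ a ⁆ ∪ ⁅ b ⁆) ⁅a⁆∪⁅b⁆⊆X)) (proj₂ (X-shattered X (λ z∈X → z∈X)))
        a≢b ca≡cb (from z∈⁅x⁆∪⁅y⁆⇔ (inj₁ refl)) (from z∈⁅x⁆∪⁅y⁆⇔ (inj₂ refl)) a∈X b∈X d∈X d∉⁅a⁆∪⁅b⁆
      where
      ⁅a⁆∪⁅b⁆⊆X : ⁅ a ⁆ ∪ ⁅ b ⁆ ⊆ X
      ⁅a⁆∪⁅b⁆⊆X = [ (λ { refl → a∈X }) , (λ { refl → b∈X }) ] ∘ to z∈⁅x⁆∪⁅y⁆⇔
      d∉⁅a⁆∪⁅b⁆ : d ∉ ⁅ a ⁆ ∪ ⁅ b ⁆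
      d∉⁅a⁆∪⁅b⁆ = [ a≢d ∘ ≡-sym , b≢d ∘ ≡-sym ] ∘ to z∈⁅x⁆∪⁅y⁆⇔

mainTheorem8 : ∀ {n : ℕ} (G : Graph n) → Bipartite G → ¬ HasC4 G → VCDimAtMost G 2
mainTheorem8 G (c , proper) noC4 X X-shattered = noThreeDistinct⇒∣p∣≤2 X noThreeDistinct
  where
  sameColour⇒HasC4 : ∀ {a b d} → a ∈ X → b ∈ X → d ∈ X → a ≢ b → a ≢ d → b ≢ d → c a ≡ c b → HasC4 G
  sameColour⇒HasC4 = shattered-sameColour⇒HasC4 G proper X-shattered
  noThreeDistinct : ∀ {x y z} → x ∈ X → y ∈ X → z ∈ X → x ≢ y → x ≢ z → y ≢ z → Data.Empty.⊥
  noThreeDistinct {x} {y} {z} x∈X y∈X z∈X x≢y x≢z y≢z with twoOfThreeEqual (c x) (c y) (c z)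
  ... | inj₁ cx≡cy        = noC4 (sameColour⇒HasC4 x∈X y∈X z∈X x≢y x≢z y≢z cx≡cy)
  ... | inj₂ (inj₁ cx≡cz) = noC4 (sameColour⇒HasC4 x∈X z∈X y∈X x≢z x≢y (≢-sym y≢z) cx≡cz)
  ... | inj₂ (inj₂ cy≡cz) = noC4 (sameColour⇒HasC4 y∈X z∈X x∈X y≢z (≢-sym x≢y) (≢-sym x≢z) cy≡cz)
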